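{- For all integers $i\ge 0$ and $j\ge 0$, there is a bijection between $\mathcal{L}(i,j)$ and $\mathcal{K}(i+1,j)$; in particular $|\mathcal{L}(i,j)|=|\mathcal{K}(i+1,j)|$.
   Context: A Kimberling path from the origin to a lattice point $(a,b)$ is a lattice path consisting of steps of finite nonnegative slope (vertical steps are not allowed); equivalently it is a sequence of lattice points $(0,0)=(x_0,y_0),(x_1,y_1),\dots,(x_m,y_m)=(a,b)$ with $m\ge1$, $x_0<x_1<\dots<x_m$ and $y_0\le y_1\le\dots\le y_m$ (the path is determined by its vertex set; e.g. the path with vertices $(0,0),(1,0),(2,0)$ is distinct from the one-step path with vertices $(0,0),(2,0)$). $\mathcal{K}(a,b)$ denotes the set of Kimberling paths terminating at $(a,b)$. For $i,j\ge 0$, $\mathcal{L}(i,j)$ is the set of sequences of positive integers $(u_1,\dots,u_i)$ such that (i) $u_k\le j+2$ for all $k$, and (ii) $u_k\ge \max\{u_1,\dots,u_{k-1}\}-1$ for all $k\ge 2$; by convention $\mathcal{L}(0,j)$ consists only of the empty sequence. For example, $\mathcal{L}(2,1)=\{11,12,13,21,22,23,32,33\}$. -}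

module Defs where

open import Data.Nat using (ℕ; zero; suc; _≤_; _<_; _⊔_; _+_)
open import Data.List using (List; []; _∷_; length)
open import Data.List.Relation.Unary.All using (All)
open import Data.Product using (Σ; _×_; _,_)
open import Data.Unit using (⊤)
open import Data.Empty using (⊥)
open import Relation.Binary.PropositionalEquality using (_≡_)

-- Condition (ii): for every k ≥ 2, u_k ≥ max{u_1,…,u_{k-1}} - 1,
-- written equivalently (on ℕ) as max{u_1,…,u_{k-1}} ≤ u_k + 1.
-- MaxCondFrom m us : the condition for the remaining terms us, given that
-- m = max of all earlier terms (at least one earlier term exists).
MaxCondFrom : ℕ → List ℕ → Set
MaxCondFrom m []       = ⊤
MaxCondFrom m (u ∷ us) = (m ≤ u + 1) × MaxCondFrom (m ⊔ u) us

MaxCond : List ℕ → Set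
MaxCond []       = ⊤
MaxCond (u ∷ us) = MaxCondFrom u us

-- sequences (u_1,…,u_i) stored in order u_1 ∷ u_2 ∷ …
IsL : ℕ → ℕ → List ℕ → Set
IsL i j us =
  (length us ≡ i) ×
  All (λ u → 1 ≤ u × u ≤ j + 2) us ×
  MaxCond us

𝓛 : ℕ → ℕ → Set
𝓛 i j = Σ (List ℕ) (IsL i j)

Point : Set
Point = ℕ × ℕ

-- p → q is a step of finite nonnegative slope: x strictly increases,
-- y weakly increases
Step : Point → Point → Set
Step (x , y) (x' , y') = (x < x') × (y ≤ y')

ChainTo : Point → List Point → Point → Set
ChainTo p []       e = ⊥
ChainTo p (q ∷ []) e = Step p q × (q ≡ e)
ChainTo p (q ∷ qs@(_ ∷ _)) e = Step p q × ChainTo q qs e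

-- A Kimberling path from (0,0) to (a,b), represented by its vertex list
-- (x_1,y_1),…,(x_m,y_m) (the origin (x_0,y_0) is implicit).
𝓚 : ℕ → ℕ → Set
𝓚 a b = Σ (List Point) (λ vs → ChainTo (0 , 0) vs (a , b))

module Submission where

-- Read u₁ … uᵢ from left to right while tracking the height h of the path built
-- so far; condition (ii) keeps the running maximum equal to h + 2, so each uₖ is
-- either h + 1 or at least h + 2.  The value h + 1 leaves column k without a
-- vertex, and a value u ≥ h + 2 places the vertex (k , u − 2).  The path ends at
-- (i + 1 , j), and condition (i) says exactly that no vertex exceeds height j.
-- Conversely, a path is read back column by column.

open import Defs
open import Data.Nat using (ℕ; zero; suc; _+_; _∸_; _≤_; _<_; _⊔_; z≤n; s≤s; _≤?_; _≟_)
open import Data.Nat.Properties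
open import Data.List using (List; []; _∷_; length)
open import Data.List.Relation.Unary.All as All using (All; []; _∷_)
open import Data.Product using (_×_; _,_; proj₁; proj₂)
open import Data.Unit using (tt)
open import Data.Empty using (⊥-elim)
open import Function using (_∘_)
open import Relation.Nullary using (yes; no; ¬_)
open import Relation.Nullary.Irrelevant using (Irrelevant)
open import Relation.Binary.PropositionalEquality
open import Axiom.UniquenessOfIdentityProofs.WithK using (uip)
open import Function.Bundles using (_⤖_; mk↔ₛ′)
open import Function.Properties.Inverse using (↔⇒⤖)

×-irrelevant : ∀ {A B : Set} → Irrelevant A → Irrelevant B → Irrelevant (A × B)
×-irrelevant irrA irrB (a , b) (a′ , b′) = cong₂ _,_ (irrA a a′) (irrB b b′)

Σ-≡-irrelevant : ∀ {A : Set} {B : A → Set} → (∀ a → Irrelevant (B a)) →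
                 ∀ {a a′} {b : B a} {b′ : B a′} → a ≡ a′ → (a , b) ≡ (a′ , b′)
Σ-≡-irrelevant irr {b = b} {b′} refl = cong (_ ,_) (irr _ b b′)

MaxCondFrom-antitone : ∀ {m m′} us → m′ ≤ m → MaxCondFrom m us → MaxCondFrom m′ us
MaxCondFrom-antitone []       _    _         = tt
MaxCondFrom-antitone (u ∷ us) m′≤m (m≤ , mc) =
  ≤-trans m′≤m m≤ , MaxCondFrom-antitone us (⊔-monoˡ-≤ u m′≤m) mc

MaxCondFrom-⊔ˡ : ∀ {k m} us → All (λ v → k ≤ v + 1) us → MaxCondFrom m us → MaxCondFrom (k ⊔ m) us
MaxCondFrom-⊔ˡ                 []       _            _         = tt
MaxCondFrom-⊔ˡ {k} {m} (u ∷ us) (k≤ ∷ ks) (m≤ , mc) =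
  ⊔-lub k≤ m≤ , subst (λ n → MaxCondFrom n us) (sym (⊔-assoc k m u)) (MaxCondFrom-⊔ˡ us ks mc)

MaxCondFrom-∷-max : ∀ {m u} us → m ≤ u → MaxCondFrom u us → MaxCondFrom m (u ∷ us)
MaxCondFrom-∷-max {u = u} us m≤u mc =
  m≤n⇒m≤n+o 1 m≤u , subst (λ n → MaxCondFrom n us) (sym (m≤n⇒m⊔n≡n m≤u)) mc

MaxCondFrom-∷-pred : ∀ {m} us → MaxCondFrom (suc m) us → MaxCondFrom (suc m) (m ∷ us)
MaxCondFrom-∷-pred {m} us mc =
  ≤-reflexive (+-comm 1 m) , subst (λ n → MaxCondFrom n us) (sym (m≥n⇒m⊔n≡m (n≤1+n m))) mc

-- The virtual maximum 2 before u₁ corresponds to the initial height 0 of the path.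
MaxCond⇒MaxCondFrom-2 : ∀ us → All (1 ≤_) us → MaxCond us → MaxCondFrom 2 us
MaxCond⇒MaxCondFrom-2 []       _            _  = tt
MaxCond⇒MaxCondFrom-2 (u ∷ us) (1≤u ∷ pos) mc =
  +-monoˡ-≤ 1 1≤u , MaxCondFrom-⊔ˡ us (All.map (+-monoˡ-≤ 1) pos) mc

MaxCondFrom-2⇒MaxCond : ∀ us → MaxCondFrom 2 us → MaxCond us
MaxCondFrom-2⇒MaxCond []       _         = tt
MaxCondFrom-2⇒MaxCond (u ∷ us) (_ , mc) = MaxCondFrom-antitone us (m≤n⊔m 2 u) mc

MaxCondFrom-irrelevant : ∀ m us → Irrelevant (MaxCondFrom m us)
MaxCondFrom-irrelevant m []       tt tt = refl
MaxCondFrom-irrelevant m (u ∷ us) (p , mc) (p′ , mc′) =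
  cong₂ _,_ (≤-irrelevant p p′) (MaxCondFrom-irrelevant (m ⊔ u) us mc mc′)

MaxCond-irrelevant : ∀ us → Irrelevant (MaxCond us)
MaxCond-irrelevant []       tt tt = refl
MaxCond-irrelevant (u ∷ us) = MaxCondFrom-irrelevant u us

Chain : Point → List Point → Point → Set
Chain p []       e = p ≡ e
Chain p (q ∷ qs) e = Step p q × Chain q qs e

ChainTo⇒Chain : ∀ {p e} vs → ChainTo p vs e → Chain p vs e
ChainTo⇒Chain (q ∷ [])     ch         = ch
ChainTo⇒Chain (q ∷ _ ∷ qs) (step , ch) = step , ChainTo⇒Chain (_ ∷ qs) ch

Chain⇒ChainTo : ∀ {p e} vs → ¬ p ≡ e → Chain p vs e → ChainTo p vs e
Chain⇒ChainTo []       p≢e p≡e = ⊥-elim (p≢e p≡e)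
Chain⇒ChainTo (q ∷ qs) _   ch  = nonempty q qs ch
  where
  nonempty : ∀ {p e} q qs → Chain p (q ∷ qs) e → ChainTo p (q ∷ qs) e
  nonempty q []       ch          = ch
  nonempty q (r ∷ qs) (step , ch) = step , nonempty r qs ch

Chain-end-≥ : ∀ {x y ex ey} vs → Chain (x , y) vs (ex , ey) → x ≤ ex × y ≤ ey
Chain-end-≥ []       refl = ≤-refl , ≤-refl
Chain-end-≥ (q ∷ qs) ((x<x′ , y≤y′) , ch) =
  let x′≤ex , y′≤ey = Chain-end-≥ qs ch in ≤-trans (<⇒≤ x<x′) x′≤ex , ≤-trans y≤y′ y′≤ey

Chain-next-column : ∀ {c h y} vs → Chain (c , h) vs (suc c , y) → vs ≡ (suc c , y) ∷ []
Chain-next-column []  c≡1+c = ⊥-elim (1+n≢n (sym (cong proj₁ c≡1+c)))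
Chain-next-column (q ∷ [])     (_ , q≡e) = cong (_∷ []) q≡e
Chain-next-column (q ∷ r ∷ qs) ((c<x , _) , (x<x′ , _) , ch) =
  ⊥-elim (<⇒≱ (≤-trans (s≤s c<x) x<x′) (proj₁ (Chain-end-≥ qs ch)))

Step-irrelevant : ∀ p q → Irrelevant (Step p q)
Step-irrelevant _ _ = ×-irrelevant ≤-irrelevant ≤-irrelevant

ChainTo-irrelevant : ∀ p vs e → Irrelevant (ChainTo p vs e)
ChainTo-irrelevant p (q ∷ [])     e = ×-irrelevant (Step-irrelevant p q) uip
ChainTo-irrelevant p (q ∷ r ∷ qs) e = ×-irrelevant (Step-irrelevant p q) (ChainTo-irrelevant q (r ∷ qs) e)

module Correspondence (j : ℕ) where

  InRange : ℕ → Set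
  InRange u = 1 ≤ u × u ≤ j + 2

  -- The terms still to be read when the path is at height h.
  Admissible : ℕ → List ℕ → Set
  Admissible h us = All InRange us × MaxCondFrom (2 + h) us

  -- The endpoint of a path whose last column read is c and which has n columns to go.
  Target : ℕ → ℕ → Point
  Target n c = n + suc c , j

  Target-suc : ∀ n c → Target n (suc c) ≡ Target (suc n) c
  Target-suc n c = cong (_, j) (+-suc n (suc c))

  Target-origin : ∀ n → Target n 0 ≡ (suc n , j)
  Target-origin n = cong (_, j) (+-comm n 1)

  Chain-[]-↛-Target : ∀ {n c h} → ¬ Chain (c , h) [] (Target n c)
  Chain-[]-↛-Target {n} {c} ch = m≢1+n+m c (trans (cong proj₁ ch) (+-suc n c))

  +2-InRange : ∀ {y} → y ≤ j → InRange (2 + y)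
  +2-InRange {y} y≤j = s≤s z≤n , ≤-trans (+-monoʳ-≤ 2 y≤j) (≤-reflexive (+-comm 2 j))

  -- (c , h) is the last column read and the current height.
  encode : Point → List ℕ → List Point
  encode (c , h) []       = (suc c , j) ∷ []
  encode (c , h) (u ∷ us) with u ≤? suc h
  ... | yes _ = encode (suc c , h) us
  ... | no  _ = (suc c , u ∸ 2) ∷ encode (suc c , u ∸ 2) us

  -- n is the number of columns still to be read; the clause for [] is junk.
  decode : ℕ → Point → List Point → List ℕ
  decode zero    _       _              = []
  decode (suc n) (c , h) []             = suc h ∷ decode n (suc c , h) []
  decode (suc n) (c , h) ((x , y) ∷ vs) with x ≟ suc c
  ... | yes _ = 2 + y ∷ decode n (x , y) vs
  ... | no  _ = suc h ∷ decode n (suc c , h) ((x , y) ∷ vs)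

  decode-length : ∀ n p vs → length (decode n p vs) ≡ n
  decode-length zero    _       _              = refl
  decode-length (suc n) (c , h) []             = cong suc (decode-length n _ [])
  decode-length (suc n) (c , h) ((x , y) ∷ vs) with x ≟ suc c
  ... | yes _ = cong suc (decode-length n _ vs)
  ... | no  _ = cong suc (decode-length n _ ((x , y) ∷ vs))

  encode-columns : ∀ c h us → All (λ q → c < proj₁ q) (encode (c , h) us)
  encode-columns c h []       = n<1+n c ∷ []
  encode-columns c h (u ∷ us) with u ≤? suc h
  ... | yes _ = All.map (<-trans (n<1+n c)) (encode-columns (suc c) h us)
  ... | no  _ = n<1+n c ∷ All.map (<-trans (n<1+n c)) (encode-columns (suc c) (u ∸ 2) us)

  decode-skip : ∀ n c h vs → All (λ q → suc c < proj₁ q) vs →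
                decode (suc n) (c , h) vs ≡ suc h ∷ decode n (suc c , h) vs
  decode-skip n c h []             _ = refl
  decode-skip n c h ((x , y) ∷ vs) (c+1<x ∷ _) with x ≟ suc c
  ... | yes x≡c+1 = ⊥-elim (<-irrefl (sym x≡c+1) c+1<x)
  ... | no  _     = refl

  -- On an admissible sequence the test u ≤? suc h separates u ≡ h + 1 from u ≥ h + 2.
  module _ {h u us} (adm : Admissible h (u ∷ us)) where

    private
      h+2≤u+1 : 2 + h ≤ u + 1
      h+2≤u+1 = proj₁ (proj₂ adm)

    repeat-height : u ≤ suc h → u ≡ suc h × Admissible h us
    repeat-height u≤h+1 =
      ≤-antisym u≤h+1 (≤-pred (subst (2 + h ≤_) (+-comm u 1) h+2≤u+1)) ,
      All.tail (proj₁ adm) ,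
      subst (λ m → MaxCondFrom m us) (m≥n⇒m⊔n≡m (m≤n⇒m≤1+n u≤h+1)) (proj₂ (proj₂ adm))

    raise-height : 2 + h ≤ u → 2 + (u ∸ 2) ≡ u × Admissible (u ∸ 2) us
    raise-height h+2≤u =
      u≡ , All.tail (proj₁ adm) ,
      subst (λ m → MaxCondFrom m us) (trans (m≤n⇒m⊔n≡n h+2≤u) (sym u≡)) (proj₂ (proj₂ adm))
      where
      u≡ : 2 + (u ∸ 2) ≡ u
      u≡ = m+[n∸m]≡n (≤-trans (s≤s (s≤s z≤n)) h+2≤u)

  encode-chain : ∀ {c′ c h} us → c′ ≤ c → h ≤ j → Admissible h us →
                 Chain (c′ , h) (encode (c , h) us) (Target (length us) c)
  encode-chain                 []       c′≤c h≤j _   = (s≤s c′≤c , h≤j) , refl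
  encode-chain {c′} {c} {h} (u ∷ us) c′≤c h≤j adm with u ≤? suc h
  ... | yes u≤h+1 =
    subst (Chain _ _) (Target-suc (length us) c)
      (encode-chain us (m≤n⇒m≤1+n c′≤c) h≤j (proj₂ (repeat-height adm u≤h+1)))
  ... | no  u≰h+1 =
    (s≤s c′≤c , ∸-monoˡ-≤ 2 h+2≤u) ,
    subst (Chain _ _) (Target-suc (length us) c)
      (encode-chain us ≤-refl u∸2≤j (proj₂ (raise-height adm h+2≤u)))
    where
    h+2≤u : 2 + h ≤ u
    h+2≤u = ≰⇒> u≰h+1
    u∸2≤j : u ∸ 2 ≤ j
    u∸2≤j = ≤-trans (∸-monoˡ-≤ 2 (proj₂ (All.head (proj₁ adm)))) (≤-reflexive (m+n∸n≡m j 2))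

  decode-admissible : ∀ n c h vs → Chain (c , h) vs (Target n c) → Admissible h (decode n (c , h) vs)
  decode-admissible zero    c h vs             ch = [] , tt
  decode-admissible (suc n) c h []             ch = ⊥-elim (Chain-[]-↛-Target {suc n} ch)
  decode-admissible (suc n) c h ((x , y) ∷ vs) ((c<x , h≤y) , ch) with x ≟ suc c
  ... | yes refl =
    let rs , mc = decode-admissible n x y vs (subst (Chain _ _) (sym (Target-suc n c)) ch)
    in  +2-InRange (proj₂ (Chain-end-≥ vs ch)) ∷ rs , MaxCondFrom-∷-max _ (s≤s (s≤s h≤y)) mc
  ... | no x≢c+1 =
    let rs , mc = decode-admissible n (suc c) h ((x , y) ∷ vs)
                    (subst (Chain _ _) (sym (Target-suc n c)) ((c+1<x , h≤y) , ch))
    in  (s≤s z≤n , ≤-trans (n≤1+n (suc h)) (proj₂ (+2-InRange h≤j))) ∷ rs , MaxCondFrom-∷-pred _ mc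
    where
    c+1<x : suc c < x
    c+1<x = ≤∧≢⇒< c<x (x≢c+1 ∘ sym)
    h≤j : h ≤ j
    h≤j = proj₂ (Chain-end-≥ ((x , y) ∷ vs) ((c<x , h≤y) , ch))

  decode-encode : ∀ c h us → Admissible h us → decode (length us) (c , h) (encode (c , h) us) ≡ us
  decode-encode c h []       _   = refl
  decode-encode c h (u ∷ us) adm with u ≤? suc h
  ... | yes u≤h+1 =
    let u≡h+1 , adm′ = repeat-height adm u≤h+1 in
    begin
      decode (suc (length us)) (c , h) (encode (suc c , h) us)
        ≡⟨ decode-skip (length us) c h _ (encode-columns (suc c) h us) ⟩
      suc h ∷ decode (length us) (suc c , h) (encode (suc c , h) us)
        ≡⟨ cong₂ _∷_ (sym u≡h+1) (decode-encode (suc c) h us adm′) ⟩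
      u ∷ us
    ∎
    where open ≡-Reasoning
  ... | no u≰h+1 with suc c ≟ suc c
  ...   | no  c+1≢c+1 = ⊥-elim (c+1≢c+1 refl)
  ...   | yes _       =
    let u≡ , adm′ = raise-height adm (≰⇒> u≰h+1)
    in  cong₂ _∷_ u≡ (decode-encode (suc c) (u ∸ 2) us adm′)

  encode-decode : ∀ n c h vs → Chain (c , h) vs (Target n c) → encode (c , h) (decode n (c , h) vs) ≡ vs
  encode-decode zero    c h vs             ch = sym (Chain-next-column vs ch)
  encode-decode (suc n) c h []             ch = ⊥-elim (Chain-[]-↛-Target {suc n} ch)
  encode-decode (suc n) c h ((x , y) ∷ vs) ((c<x , h≤y) , ch) with x ≟ suc c
  ... | yes refl with 2 + y ≤? suc h
  ...   | yes y+2≤h+1 = ⊥-elim (<⇒≱ (≤-pred y+2≤h+1) h≤y)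
  ...   | no  _       =
    cong ((x , y) ∷_) (encode-decode n x y vs (subst (Chain _ _) (sym (Target-suc n c)) ch))
  encode-decode (suc n) c h ((x , y) ∷ vs) ((c<x , h≤y) , ch) | no x≢c+1 with suc h ≤? suc h
  ... | no  h+1≰h+1 = ⊥-elim (h+1≰h+1 ≤-refl)
  ... | yes _       =
    encode-decode n (suc c) h ((x , y) ∷ vs)
      (subst (Chain _ _) (sym (Target-suc n c)) ((≤∧≢⇒< c<x (x≢c+1 ∘ sym) , h≤y) , ch))

module _ (i j : ℕ) where
  open Correspondence j

  IsL⇒Admissible : ∀ {us} → IsL i j us → Admissible 0 us
  IsL⇒Admissible {us} (_ , rs , mc) = rs , MaxCond⇒MaxCondFrom-2 us (All.map proj₁ rs) mc

  K⇒Chain : ∀ {vs} → ChainTo (0 , 0) vs (suc i , j) → Chain (0 , 0) vs (Target i 0)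
  K⇒Chain {vs} ch = subst (Chain _ vs) (sym (Target-origin i)) (ChainTo⇒Chain vs ch)

  L→K : 𝓛 i j → 𝓚 (suc i) j
  L→K (us , isL@(len , _)) =
    encode (0 , 0) us ,
    Chain⇒ChainTo _ (λ ()) (subst (Chain _ _) (trans (cong (λ n → Target n 0) len) (Target-origin i))
                             (encode-chain us z≤n z≤n (IsL⇒Admissible isL)))

  K→L : 𝓚 (suc i) j → 𝓛 i j
  K→L (vs , ch) =
    let rs , mc = decode-admissible i 0 0 vs (K⇒Chain ch)
    in  decode i (0 , 0) vs , decode-length i _ vs , rs , MaxCondFrom-2⇒MaxCond _ mc

  L→K→L : ∀ us → K→L (L→K us) ≡ us
  L→K→L (us , isL@(len , _)) =
    Σ-≡-irrelevant IsL-irrelevant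
      (trans (cong (λ n → decode n (0 , 0) (encode (0 , 0) us)) (sym len))
             (decode-encode 0 0 us (IsL⇒Admissible isL)))
    where
    IsL-irrelevant : ∀ vs → Irrelevant (IsL i j vs)
    IsL-irrelevant vs = ×-irrelevant ≡-irrelevant
      (×-irrelevant (All.irrelevant (×-irrelevant ≤-irrelevant ≤-irrelevant)) (MaxCond-irrelevant vs))

  K→L→K : ∀ vs → L→K (K→L vs) ≡ vs
  K→L→K (vs , ch) =
    Σ-≡-irrelevant (λ ws → ChainTo-irrelevant (0 , 0) ws (suc i , j)) (encode-decode i 0 0 vs (K⇒Chain ch))

mainTheorem2 : (i j : ℕ) → 𝓛 i j ⤖ 𝓚 (suc i) j
mainTheorem2 i j = ↔⇒⤖ (mk↔ₛ′ (L→K i j) (K→L i j) (K→L→K i j) (L→K→L i j))
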